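{- Let $G=C(n;\{1,2,\dots,k\})$ where $n\geq 4$ and $1\leq k<\lfloor n/2\rfloor$. Then $G$ is a hypo-unique domination graph if and only if $2k+1$ divides $n-1$. Moreover, if $2k+1$ divides $n-1$, then $n=(\Delta(G)+1)(\gamma(G)-1)+1$ and $G$ is a hypo-efficient domination graph.
   Context: All graphs are finite, simple and undirected; $\Delta(G)$ is the maximum degree. For a set $S=\{n_1<\dots<n_k\}$ of integers with $0<n_1$ and $n_k<(n+1)/2$, the circulant graph $C(n;S)$ has vertex set $\{0,1,\dots,n-1\}$, with each vertex $i$ adjacent to $i\pm n_1,\dots,i\pm n_k \pmod n$. A dominating set of $G$ is a set $D\subseteq V(G)$ such that every vertex not in $D$ has a neighbor in $D$; $\gamma(G)$ is the minimum size of a dominating set, and a dominating set of size $\gamma(G)$ is a $\gamma$-set. An efficient dominating set (EDS) of $G$ is a set $D\subseteq V(G)$ with $|N[v]\cap D|=1$ for every $v\in V(G)$, where $N[v]$ is the closed neighborhood of $v$. A graph $G$ is a hypo-efficient domination graph if $G$ has no EDS but $G-v$ has at least one EDS for every $v\in V(G)$. A graph $G$ is a hypo-unique domination graph if $G$ has at least two distinct $\gamma$-sets, but for every $v\in V(G)$ the graph $G-v$ has exactly one $\gamma$-set. -}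

module Defs where

open import Data.Bool using (Bool; true; false; _∨_; _∧_; if_then_else_)
open import Data.Nat using (ℕ; zero; suc; _+_; _*_; _∸_; _≤_; _≤ᵇ_; _≡ᵇ_; _⊔_; ∣_-_∣)
open import Data.Fin using (Fin; toℕ; _≟_)
open import Data.Fin.Subset using (Subset; _∈_; _∉_; _⊆_; _∩_; ∣_∣; ⊤; ⁅_⁆; ∁)
open import Data.List using (List; map; upTo; allFin; foldr)
open import Data.Bool.ListAction using (any)
open import Data.Vec using (tabulate)
open import Data.Product using (Σ; ∃; ∃-syntax; _×_; _,_)
open import Relation.Nullary using (¬_; does)
open import Relation.Binary.PropositionalEquality using (_≡_; _≢_)

Graph : ℕ → Set
Graph n = Fin n → Fin n → Bool

-- Circulant graph C(n; S): i ~ j iff (j - i) mod n ∈ ±S, i.e. with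
-- d = |i - j| (0 ≤ d < n): d ∈ S or n - d ∈ S.
circulant : (n : ℕ) → List ℕ → Graph n
circulant n S i j =
  let d = ∣ toℕ i - toℕ j ∣ in
  any (d ≡ᵇ_) S ∨ any ((n ∸ d) ≡ᵇ_) S

oneTo : ℕ → List ℕ
oneTo k = map suc (upTo k)

C : (n k : ℕ) → Graph n
C n k = circulant n (oneTo k)

module _ {n : ℕ} (G : Graph n) where

  N : Fin n → Subset n
  N v = tabulate (G v)

  N[_] : Fin n → Subset n
  N[ v ] = tabulate (λ w → does (v ≟ w) ∨ G v w)

  degree : Fin n → ℕ
  degree v = ∣ N v ∣

  Δ : ℕ
  Δ = foldr _⊔_ 0 (map degree (allFin n))

  -- All notions below are relative to the induced subgraph G[V] on a vertex
  -- set V ⊆ Fin n; G itself is V = ⊤ and G - v is V = ∁ ⁅ v ⁆.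

  IsDominating : Subset n → Subset n → Set
  IsDominating V D =
    D ⊆ V × (∀ u → u ∈ V → u ∉ D → ∃[ w ] (w ∈ D × G u w ≡ true))

  IsGammaSet : Subset n → Subset n → Set
  IsGammaSet V D =
    IsDominating V D × (∀ D′ → IsDominating V D′ → ∣ D ∣ ≤ ∣ D′ ∣)

  IsDominationNumber : Subset n → ℕ → Set
  IsDominationNumber V g = ∃[ D ] (IsGammaSet V D × ∣ D ∣ ≡ g)

  IsEDS : Subset n → Subset n → Set
  IsEDS V D = D ⊆ V × (∀ v → v ∈ V → ∣ N[ v ] ∩ D ∣ ≡ 1)

  HasEDS : Subset n → Set
  HasEDS V = ∃[ D ] IsEDS V D

  HasUniqueGammaSet : Subset n → Set
  HasUniqueGammaSet V = ∃[ D ] (IsGammaSet V D × (∀ D′ → IsGammaSet V D′ → D′ ≡ D))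

  IsHypoEfficient : Set
  IsHypoEfficient = ¬ HasEDS ⊤ × (∀ v → HasEDS (∁ ⁅ v ⁆))

  IsHypoUnique : Set
  IsHypoUnique =
    (∃[ D₁ ] ∃[ D₂ ] (IsGammaSet ⊤ D₁ × IsGammaSet ⊤ D₂ × D₁ ≢ D₂))
    × (∀ v → HasUniqueGammaSet (∁ ⁅ v ⁆))

module Submission where

-- Every closed neighbourhood of G = C(n; {1, …, k}) has q = 2k + 1 vertices, so double counting gives
-- |V| ≤ q |D| whenever D dominates V, with equality only if D dominates V efficiently and no closed
-- neighbourhood of a vertex of D leaves V. Seen from a removed vertex v, G - v is dominated like a path
-- on the positions 1, …, n - 1. If n - 1 = m q, the vertices at positions k + 1 + j q (j < m) form an
-- efficient dominating set of G - v, and the equality case forces every γ-set of G - v to be this set;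
-- adding v gives a γ-set of G of size m + 1, and different v give different γ-sets. G itself has no
-- EDS, since q does not divide n = m q + 1. If n - 1 = r + m q with 0 < r < q, there is room to shift
-- the progression of centres, which yields two different γ-sets of G - v.

open import Defs
open import Data.Bool using (Bool; true; false; _∨_; _∧_; if_then_else_; T)
open import Data.Bool.ListAction using (any)
open import Data.Bool.Properties using (∨-zeroʳ; ∨-identityʳ; ∨-comm; T-≡)
open import Data.Fin using (Fin; toℕ; fromℕ<; _≟_) renaming (zero to fzero; suc to fsuc)
open import Data.Fin.Properties using (toℕ<n; toℕ-injective; toℕ-fromℕ<)
open import Data.Fin.Subset using (Subset; _∈_; _∉_; _⊆_; _∩_; ∣_∣; ⊤; ⁅_⁆; ∁)
open import Data.Fin.Subset.Properties
  using (_∈?_; ⊆⊤; ⊆-antisym; p⊂q⇒∣p∣<∣q∣; p∩q⊆p; ∣p∩q∣≤∣p∣; ∩-identityʳ; x∈p∩q⁺; x∈p∩q⁻; ∈⊤; ∣⊤∣≡n;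
         x∈⁅x⁆; x∈⁅y⁆⇒x≡y; x≢y⇒x∉⁅y⁆; ∣⁅x⁆∣≡1; x∈p⇒∣p-x∣<∣p∣; x∉p⇒x∈∁p; x∈∁p⇒x∉p; ∣∁p∣≡n∸∣p∣)
open import Data.List using ([]; _∷_; map; foldr)
open import Data.List.Membership.Propositional.Properties using (∈-map⁺; ∈-map⁻; ∈-upTo⁺; ∈-upTo⁻)
import Data.List.Relation.Unary.Any as Any
open import Data.List.Relation.Unary.Any.Properties using (any⁺; any⁻)
open import Data.Nat
  using (ℕ; zero; suc; _+_; _*_; _∸_; _≤_; _<_; z≤n; s≤s; s≤s⁻¹; _⊔_; _≡ᵇ_; _≤ᵇ_; ∣_-_∣; _%_; _/_)
open import Data.Nat.DivMod using (m≡m%n+[m/n]*n; m*n%n≡0; m%n<n; [m+n]%n≡m%n; [m+kn]%n≡m%n; m<n⇒m%n≡m; m/n*n≤m)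
open import Data.Nat.Divisibility using (_∣_; divides; m%n≡0⇒n∣m)
open import Data.Nat.Properties renaming (_≟_ to _≟ℕ_)
open import Data.Nat.Tactic.RingSolver using (solve-∀)
open import Algebra.Properties.Semiring.Sum +-*-semiring
  using (sum; sum-cong-≗; ∑-comm; *-distribˡ-sum; *-distribʳ-sum)
open import Data.Product using (∃-syntax; _×_; _,_; proj₁; proj₂)
open import Data.Sum using (_⊎_; inj₁; inj₂)
open import Data.Vec using ([]; _∷_; lookup; tabulate)
open import Data.Vec.Properties
  using (lookup∘tabulate; tabulate∘lookup; tabulate-cong; lookup-zipWith; []=⇒lookup; lookup⇒[]=)
open import Function using (_∘_; Equivalence)
open import Function.Bundles using (_⇔_; mk⇔)
open import Relation.Nullary using (¬_; Dec; yes; no; does; contradiction)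
open import Relation.Nullary.Decidable using (dec-true; dec-false)
open import Relation.Binary.PropositionalEquality

⟦_⟧ : Bool → ℕ
⟦ true ⟧ = 1
⟦ false ⟧ = 0

⟦∧⟧ : ∀ a b → ⟦ a ∧ b ⟧ ≡ ⟦ a ⟧ * ⟦ b ⟧
⟦∧⟧ true b = sym (+-identityʳ ⟦ b ⟧)
⟦∧⟧ false b = refl

sum-mono : ∀ {n} {f g : Fin n → ℕ} → (∀ i → f i ≤ g i) → sum f ≤ sum g
sum-mono {zero} f≤g = z≤n
sum-mono {suc n} f≤g = +-mono-≤ (f≤g fzero) (sum-mono (f≤g ∘ fsuc))

sum-mono-tight : ∀ {n} {f g : Fin n → ℕ} → (∀ i → f i ≤ g i) → sum g ≤ sum f → ∀ i → f i ≡ g i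
sum-mono-tight {suc n} {f} {g} f≤g ∑g≤∑f = tight
  where
  tail≤ : sum (f ∘ fsuc) ≤ sum (g ∘ fsuc)
  tail≤ = sum-mono (f≤g ∘ fsuc)
  tight : ∀ i → f i ≡ g i
  tight fzero = ≤-antisym (f≤g fzero)
    (+-cancelʳ-≤ _ _ _ (≤-trans ∑g≤∑f (+-monoʳ-≤ (f fzero) tail≤)))
  tight (fsuc i) = sum-mono-tight (f≤g ∘ fsuc)
    (+-cancelˡ-≤ (g fzero) _ _ (≤-trans ∑g≤∑f (+-monoˡ-≤ _ (f≤g fzero)))) i

χ : ∀ {n} → Subset n → Fin n → ℕ
χ p i = ⟦ lookup p i ⟧

∣p∣≡∑χ : ∀ {n} (p : Subset n) → ∣ p ∣ ≡ sum (χ p)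
∣p∣≡∑χ [] = refl
∣p∣≡∑χ (true ∷ p) = cong suc (∣p∣≡∑χ p)
∣p∣≡∑χ (false ∷ p) = ∣p∣≡∑χ p

∣p∩q∣≡∑χχ : ∀ {n} (p q : Subset n) → ∣ p ∩ q ∣ ≡ sum (λ i → χ p i * χ q i)
∣p∩q∣≡∑χχ p q = trans (∣p∣≡∑χ (p ∩ q))
  (sum-cong-≗ λ i → trans (cong ⟦_⟧ (lookup-zipWith _∧_ i p q)) (⟦∧⟧ (lookup p i) (lookup q i)))

∑χ*≡∣∣* : ∀ {n} (p : Subset n) c → sum (λ i → χ p i * c) ≡ ∣ p ∣ * c
∑χ*≡∣∣* p c = trans (sym (*-distribʳ-sum c (χ p))) (cong (_* c) (sym (∣p∣≡∑χ p)))

χ-∈ : ∀ {n} {p : Subset n} {i} → i ∈ p → χ p i ≡ 1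
χ-∈ i∈p = cong ⟦_⟧ ([]=⇒lookup i∈p)

x∈p⇒0<∣p∣ : ∀ {n} {p : Subset n} {x} → x ∈ p → 0 < ∣ p ∣
x∈p⇒0<∣p∣ x∈p = ≤-<-trans z≤n (x∈p⇒∣p-x∣<∣p∣ x∈p)

⊆-∣∣-antisym : ∀ {n} {p q : Subset n} → p ⊆ q → ∣ q ∣ ≤ ∣ p ∣ → p ≡ q
⊆-∣∣-antisym {p = p} {q} p⊆q ∣q∣≤∣p∣ = ⊆-antisym p⊆q q⊆p
  where
  q⊆p : q ⊆ p
  q⊆p {x} x∈q with x ∈? p
  ... | yes x∈p = x∈p
  ... | no x∉p = contradiction (p⊂q⇒∣p∣<∣q∣ (p⊆q , x , x∈q , x∉p)) (≤⇒≯ ∣q∣≤∣p∣)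

∣p∣≡1⇒⁅x⁆≡p : ∀ {n} {p : Subset n} {x} → ∣ p ∣ ≡ 1 → x ∈ p → ⁅ x ⁆ ≡ p
∣p∣≡1⇒⁅x⁆≡p {p = p} {x} ∣p∣≡1 x∈p = ⊆-∣∣-antisym ⁅x⁆⊆p (≤-reflexive (trans ∣p∣≡1 (sym (∣⁅x⁆∣≡1 x))))
  where
  ⁅x⁆⊆p : ⁅ x ⁆ ⊆ p
  ⁅x⁆⊆p y∈⁅x⁆ = subst (_∈ p) (sym (x∈⁅y⁆⇒x≡y x y∈⁅x⁆)) x∈p

∣p∣≡1-unique : ∀ {n} {p : Subset n} {x y} → ∣ p ∣ ≡ 1 → x ∈ p → y ∈ p → x ≡ y
∣p∣≡1-unique {x = x} ∣p∣≡1 x∈p y∈p =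
  sym (x∈⁅y⁆⇒x≡y x (subst (_ ∈_) (sym (∣p∣≡1⇒⁅x⁆≡p ∣p∣≡1 x∈p)) y∈p))

∣p∩q∣≡∣p∣⇒p⊆q : ∀ {n} {p q : Subset n} → ∣ p ∩ q ∣ ≡ ∣ p ∣ → p ⊆ q
∣p∩q∣≡∣p∣⇒p⊆q {p = p} {q} eq x∈p =
  proj₂ (x∈p∩q⁻ p q (subst (_ ∈_) (sym (⊆-∣∣-antisym (p∩q⊆p p q) (≤-reflexive (sym eq)))) x∈p))

∣tabulate-≟∨∣ : ∀ {n} (v : Fin n) (f : Fin n → Bool) → f v ≡ false →
  ∣ tabulate (λ w → does (v ≟ w) ∨ f w) ∣ ≡ suc ∣ tabulate f ∣
∣tabulate-≟∨∣ fzero f fv≡false rewrite fv≡false = refl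
∣tabulate-≟∨∣ (fsuc v) f fv≡false with f fzero
... | true = cong suc (∣tabulate-≟∨∣ v (f ∘ fsuc) fv≡false)
... | false = ∣tabulate-≟∨∣ v (f ∘ fsuc) fv≡false

does-≟-sym : ∀ {n} (u w : Fin n) → does (u ≟ w) ≡ does (w ≟ u)
does-≟-sym u w with u ≟ w | w ≟ u
... | yes _ | yes _ = refl
... | no _ | no _ = refl
... | yes u≡w | no w≢u = contradiction (sym u≡w) w≢u
... | no u≢w | yes w≡u = contradiction (sym w≡u) u≢w

module _ {n : ℕ} (G : Graph n) where

  ∈-N[] : ∀ {u w} → does (u ≟ w) ∨ G u w ≡ true → w ∈ N[_] G u
  ∈-N[] {u} {w} e = lookup⇒[]= w (N[_] G u) (trans (lookup∘tabulate _ w) e)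

  u∈N[u] : ∀ u → u ∈ N[_] G u
  u∈N[u] u = ∈-N[] (cong (_∨ G u u) (dec-true (u ≟ u) refl))

  G⇒∈N[] : ∀ {u w} → G u w ≡ true → w ∈ N[_] G u
  G⇒∈N[] {u} {w} e = ∈-N[] (trans (cong (does (u ≟ w) ∨_) e) (∨-zeroʳ _))

  dominator : ∀ {V D} → IsDominating G V D → ∀ {u} → u ∈ V → ∃[ w ] w ∈ D × w ∈ N[_] G u
  dominator {D = D} (_ , dom) {u} u∈V with u ∈? D
  ... | yes u∈D = u , u∈D , u∈N[u] u
  ... | no u∉D with dom u u∈V u∉D
  ...   | w , w∈D , Guw = w , w∈D , G⇒∈N[] Guw

  ∣N[]∣≡suc-degree : ∀ v → G v v ≡ false → ∣ N[_] G v ∣ ≡ suc (degree G v)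
  ∣N[]∣≡suc-degree v = ∣tabulate-≟∨∣ v (G v)

  Δ-regular : ∀ d → (∀ v → degree G v ≡ d) → 0 < n → Δ G ≡ d
  Δ-regular d deg≡d (s≤s z≤n) = foldr-⊔ fzero (Data.List.tabulate fsuc)
    where
    foldr-⊔ : ∀ v vs → foldr _⊔_ 0 (map (degree G) (v ∷ vs)) ≡ d
    foldr-⊔ v [] = trans (⊔-identityʳ _) (deg≡d v)
    foldr-⊔ v (w ∷ ws) = trans (cong₂ _⊔_ (deg≡d v) (foldr-⊔ w ws)) (⊔-idem d)

module Regular {n : ℕ} (G : Graph n) (G-sym : ∀ u w → G u w ≡ G w u)
                (q : ℕ) (∣N[]∣≡q : ∀ w → ∣ N[_] G w ∣ ≡ q) where

  χN[]-sym : ∀ u w → χ (N[_] G u) w ≡ χ (N[_] G w) u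
  χN[]-sym u w = cong ⟦_⟧ (begin
    lookup (N[_] G u) w        ≡⟨ lookup∘tabulate _ w ⟩
    does (u ≟ w) ∨ G u w      ≡⟨ cong₂ _∨_ (does-≟-sym u w) (G-sym u w) ⟩
    does (w ≟ u) ∨ G w u      ≡⟨ lookup∘tabulate _ u ⟨
    lookup (N[_] G w) u        ∎)
    where open ≡-Reasoning

  ∑-dominations-comm : ∀ V D →
    sum (λ u → χ V u * ∣ N[_] G u ∩ D ∣) ≡ sum (λ w → χ D w * ∣ N[_] G w ∩ V ∣)
  ∑-dominations-comm V D = begin
    sum (λ u → χ V u * ∣ N[_] G u ∩ D ∣)
      ≡⟨ sum-cong-≗ (λ u → cong (χ V u *_) (∣p∩q∣≡∑χχ (N[_] G u) D)) ⟩
    sum (λ u → χ V u * sum (λ w → χ (N[_] G u) w * χ D w))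
      ≡⟨ sum-cong-≗ (λ u → *-distribˡ-sum (χ V u) (λ w → χ (N[_] G u) w * χ D w)) ⟩
    sum (λ u → sum (λ w → χ V u * (χ (N[_] G u) w * χ D w)))
      ≡⟨ ∑-comm (λ u w → χ V u * (χ (N[_] G u) w * χ D w)) ⟩
    sum (λ w → sum (λ u → χ V u * (χ (N[_] G u) w * χ D w)))
      ≡⟨ sum-cong-≗ (λ w → sum-cong-≗ (λ u → term u w)) ⟩
    sum (λ w → sum (λ u → χ D w * (χ (N[_] G w) u * χ V u)))
      ≡⟨ sum-cong-≗ (λ w → *-distribˡ-sum (χ D w) (λ u → χ (N[_] G w) u * χ V u)) ⟨
    sum (λ w → χ D w * sum (λ u → χ (N[_] G w) u * χ V u))
      ≡⟨ sum-cong-≗ (λ w → cong (χ D w *_) (∣p∩q∣≡∑χχ (N[_] G w) V)) ⟨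
    sum (λ w → χ D w * ∣ N[_] G w ∩ V ∣) ∎
    where
    open ≡-Reasoning
    term : ∀ u w → χ V u * (χ (N[_] G u) w * χ D w) ≡ χ D w * (χ (N[_] G w) u * χ V u)
    term u w = begin
      χ V u * (χ (N[_] G u) w * χ D w) ≡⟨ *-rotate (χ V u) (χ (N[_] G u) w) (χ D w) ⟩
      χ D w * (χ (N[_] G u) w * χ V u) ≡⟨ cong (λ b → χ D w * (b * χ V u)) (χN[]-sym u w) ⟩
      χ D w * (χ (N[_] G w) u * χ V u) ∎
      where
      *-rotate : ∀ a b c → a * (b * c) ≡ c * (b * a)
      *-rotate = solve-∀

  module _ {V D : Subset n} (D-dom : IsDominating G V D) where

    χ≤χ*dominations : ∀ u → χ V u ≤ χ V u * ∣ N[_] G u ∩ D ∣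
    χ≤χ*dominations u with lookup V u in eq
    ... | false = z≤n
    ... | true with dominator G D-dom (lookup⇒[]= u V eq)
    ...   | w , w∈D , w∈N[u] = ≤-trans (x∈p⇒0<∣p∣ (x∈p∩q⁺ (w∈N[u] , w∈D))) (≤-reflexive (sym (+-identityʳ _)))

    χ*dominations≤χ*q : ∀ w → χ D w * ∣ N[_] G w ∩ V ∣ ≤ χ D w * q
    χ*dominations≤χ*q w = *-monoʳ-≤ (χ D w) (≤-trans (∣p∩q∣≤∣p∣ (N[_] G w) V) (≤-reflexive (∣N[]∣≡q w)))

    ∑dominations≤∣D∣*q : sum (λ u → χ V u * ∣ N[_] G u ∩ D ∣) ≤ ∣ D ∣ * q
    ∑dominations≤∣D∣*q = begin
      sum (λ u → χ V u * ∣ N[_] G u ∩ D ∣) ≡⟨ ∑-dominations-comm V D ⟩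
      sum (λ w → χ D w * ∣ N[_] G w ∩ V ∣) ≤⟨ sum-mono χ*dominations≤χ*q ⟩
      sum (λ w → χ D w * q)               ≡⟨ ∑χ*≡∣∣* D q ⟩
      ∣ D ∣ * q                            ∎
      where open ≤-Reasoning

    ∣V∣≤∑dominations : ∣ V ∣ ≤ sum (λ u → χ V u * ∣ N[_] G u ∩ D ∣)
    ∣V∣≤∑dominations = ≤-trans (≤-reflexive (∣p∣≡∑χ V)) (sum-mono χ≤χ*dominations)

    domination-bound : ∣ V ∣ ≤ ∣ D ∣ * q
    domination-bound = ≤-trans ∣V∣≤∑dominations ∑dominations≤∣D∣*q

    -- In the equality case both estimates of the double count are tight.
    tight-domination : ∣ D ∣ * q ≤ ∣ V ∣ →
      (∀ {u} → u ∈ V → ∣ N[_] G u ∩ D ∣ ≡ 1) × (∀ {w} → w ∈ D → N[_] G w ⊆ V)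
    tight-domination ∣D∣*q≤∣V∣ = once , closed
      where
      once : ∀ {u} → u ∈ V → ∣ N[_] G u ∩ D ∣ ≡ 1
      once {u} u∈V = sym (trans eq (*-identityˡ _))
        where
        eq : 1 ≡ 1 * ∣ N[_] G u ∩ D ∣
        eq = subst (λ c → c ≡ c * ∣ N[_] G u ∩ D ∣) (χ-∈ u∈V)
          (sum-mono-tight χ≤χ*dominations
            (≤-trans ∑dominations≤∣D∣*q (≤-trans ∣D∣*q≤∣V∣ (≤-reflexive (∣p∣≡∑χ V)))) u)
      closed : ∀ {w} → w ∈ D → N[_] G w ⊆ V
      closed {w} w∈D = ∣p∩q∣≡∣p∣⇒p⊆q {p = N[_] G w} {q = V}
        (trans (sym (*-identityˡ _)) (trans eq (trans (*-identityˡ q) (sym (∣N[]∣≡q w)))))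
        where
        eq : 1 * ∣ N[_] G w ∩ V ∣ ≡ 1 * q
        eq = subst (λ c → c * ∣ N[_] G w ∩ V ∣ ≡ c * q) (χ-∈ w∈D)
          (sum-mono-tight χ*dominations≤χ*q (begin
            sum (λ w → χ D w * q)                ≡⟨ ∑χ*≡∣∣* D q ⟩
            ∣ D ∣ * q                             ≤⟨ ∣D∣*q≤∣V∣ ⟩
            ∣ V ∣                                 ≤⟨ ∣V∣≤∑dominations ⟩
            sum (λ u → χ V u * ∣ N[_] G u ∩ D ∣) ≡⟨ ∑-dominations-comm V D ⟩
            sum (λ w → χ D w * ∣ N[_] G w ∩ V ∣) ∎) w)
          where open ≤-Reasoning

  EDS⇒n≡∣D∣*q : ∀ {D} → IsEDS G ⊤ D → n ≡ ∣ D ∣ * q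
  EDS⇒n≡∣D∣*q {D} (_ , once) = begin
    n                                    ≡⟨ ∣⊤∣≡n n ⟨
    ∣ V ∣                                ≡⟨ ∣p∣≡∑χ V ⟩
    sum (χ V)                            ≡⟨ sum-cong-≗ (λ u → *-identityʳ (χ V u)) ⟨
    sum (λ u → χ V u * 1)                ≡⟨ sum-cong-≗ (λ u → cong (χ V u *_) (once u ∈⊤)) ⟨
    sum (λ u → χ V u * ∣ N[_] G u ∩ D ∣) ≡⟨ ∑-dominations-comm V D ⟩
    sum (λ w → χ D w * ∣ N[_] G w ∩ V ∣) ≡⟨ sum-cong-≗ (λ w → cong (λ p → χ D w * ∣ p ∣) (∩-identityʳ (N[_] G w))) ⟩
    sum (λ w → χ D w * ∣ N[_] G w ∣)     ≡⟨ sum-cong-≗ (λ w → cong (χ D w *_) (∣N[]∣≡q w)) ⟩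
    sum (λ w → χ D w * q)                ≡⟨ ∑χ*≡∣∣* D q ⟩
    ∣ D ∣ * q                            ∎
    where
    open ≡-Reasoning
    V : Subset n
    V = ⊤

≤ᵇ-true : ∀ {m n} → m ≤ n → (m ≤ᵇ n) ≡ true
≤ᵇ-true {m} {n} m≤n = dec-true (m ≤? n) m≤n

≤ᵇ-false : ∀ {m n} → n < m → (m ≤ᵇ n) ≡ false
≤ᵇ-false {m} {n} n<m = dec-false (m ≤? n) (<⇒≱ n<m)

≤ᵇ-true⁻ : ∀ {m n} → (m ≤ᵇ n) ≡ true → m ≤ n
≤ᵇ-true⁻ {m} {n} eq = ≤ᵇ⇒≤ m n (Equivalence.from T-≡ eq)

≤ᵇ-false⁻ : ∀ {m n} → (m ≤ᵇ n) ≡ false → n < m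
≤ᵇ-false⁻ {m} {n} eq = ≰⇒> (λ m≤n → contradiction (trans (sym (≤ᵇ-true m≤n)) eq) λ ())

count : ℕ → (ℕ → Bool) → ℕ
count zero P = 0
count (suc n) P = ⟦ P 0 ⟧ + count n (P ∘ suc)

count-cong : ∀ n {P Q : ℕ → Bool} → (∀ y → y < n → P y ≡ Q y) → count n P ≡ count n Q
count-cong zero P≡Q = refl
count-cong (suc n) P≡Q = cong₂ _+_ (cong ⟦_⟧ (P≡Q 0 (s≤s z≤n))) (count-cong n (λ y y<n → P≡Q (suc y) (s≤s y<n)))

count-+ : ∀ a b P → count (a + b) P ≡ count a P + count b (λ y → P (a + y))
count-+ zero b P = refl
count-+ (suc a) b P = trans (cong (⟦ P 0 ⟧ +_) (count-+ a b (P ∘ suc))) (sym (+-assoc ⟦ P 0 ⟧ _ _))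

count-false : ∀ n {P : ℕ → Bool} → (∀ y → y < n → P y ≡ false) → count n P ≡ 0
count-false zero P≡false = refl
count-false (suc n) P≡false =
  cong₂ _+_ (cong ⟦_⟧ (P≡false 0 (s≤s z≤n))) (count-false n (λ y y<n → P≡false (suc y) (s≤s y<n)))

count-true : ∀ n {P : ℕ → Bool} → (∀ y → y < n → P y ≡ true) → count n P ≡ n
count-true zero P≡true = refl
count-true (suc n) P≡true =
  cong₂ _+_ (cong ⟦_⟧ (P≡true 0 (s≤s z≤n))) (count-true n (λ y y<n → P≡true (suc y) (s≤s y<n)))

count-mono : ∀ {m n} P → m ≤ n → count m P ≤ count n P
count-mono {m} P m≤n with m≤n⇒∃[o]m+o≡n m≤n
... | o , refl = ≤-trans (m≤m+n _ _) (≤-reflexive (sym (count-+ m o P)))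

count-∨-≡ᵇ : ∀ n t P → count n (λ y → P y ∨ (y ≡ᵇ t)) ≤ count n P + 1
count-∨-≡ᵇ zero t P = z≤n
count-∨-≡ᵇ (suc n) zero P = begin
  ⟦ P 0 ∨ true ⟧ + count n (λ y → P (suc y) ∨ false) ≡⟨ cong₂ (λ b c → ⟦ b ⟧ + c) (∨-zeroʳ (P 0))
                                                          (count-cong n (λ y _ → ∨-identityʳ (P (suc y)))) ⟩
  1 + count n (P ∘ suc)                              ≤⟨ +-monoʳ-≤ 1 (m≤n+m _ ⟦ P 0 ⟧) ⟩
  1 + (⟦ P 0 ⟧ + count n (P ∘ suc))                  ≡⟨ +-comm 1 _ ⟩
  ⟦ P 0 ⟧ + count n (P ∘ suc) + 1                    ∎
  where open ≤-Reasoning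
count-∨-≡ᵇ (suc n) (suc t) P = begin
  ⟦ P 0 ∨ false ⟧ + count n (λ y → P (suc y) ∨ (y ≡ᵇ t))
    ≡⟨ cong (λ b → ⟦ b ⟧ + count n (λ y → P (suc y) ∨ (y ≡ᵇ t))) (∨-identityʳ (P 0)) ⟩
  ⟦ P 0 ⟧ + count n (λ y → P (suc y) ∨ (y ≡ᵇ t))         ≤⟨ +-monoʳ-≤ ⟦ P 0 ⟧ (count-∨-≡ᵇ n t (P ∘ suc)) ⟩
  ⟦ P 0 ⟧ + (count n (P ∘ suc) + 1)                      ≡⟨ +-assoc ⟦ P 0 ⟧ _ 1 ⟨
  ⟦ P 0 ⟧ + count n (P ∘ suc) + 1                        ∎
  where open ≤-Reasoning

∣tabulate∣≡count : ∀ n (P : ℕ → Bool) → ∣ tabulate {n = n} (P ∘ toℕ) ∣ ≡ count n P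
∣tabulate∣≡count zero P = refl
∣tabulate∣≡count (suc n) P with P 0
... | true = cong suc (∣tabulate∣≡count n (P ∘ suc))
... | false = ∣tabulate∣≡count n (P ∘ suc)

-- The position of y when 0, …, n - 1 are read cyclically starting from x.
module Offset (n : ℕ) where

  offset : ℕ → ℕ → ℕ
  offset x y = if x ≤ᵇ y then y ∸ x else y + (n ∸ x)

  offset-≤ : ∀ {x y} → x ≤ y → offset x y ≡ y ∸ x
  offset-≤ x≤y rewrite ≤ᵇ-true x≤y = refl

  offset-> : ∀ {x y} → y < x → offset x y ≡ y + (n ∸ x)
  offset-> y<x rewrite ≤ᵇ-false y<x = refl

  offset-self : ∀ x → offset x x ≡ 0
  offset-self x = trans (offset-≤ (≤-refl {x})) (n∸n≡0 x)

  offset-+ : ∀ x a → offset x (x + a) ≡ a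
  offset-+ x a = trans (offset-≤ (m≤m+n x a)) (m+n∸m≡n x a)

  offset-<n : ∀ {x y} → x < n → y < n → offset x y < n
  offset-<n {x} {y} x<n y<n with x ≤? y
  ... | yes x≤y = subst (_< n) (sym (offset-≤ x≤y)) (≤-<-trans (m∸n≤m y x) y<n)
  ... | no x≰y = subst (_< n) (sym (offset-> (≰⇒> x≰y)))
                   (subst (y + (n ∸ x) <_) (m+[n∸m]≡n (<⇒≤ x<n)) (+-monoˡ-< (n ∸ x) (≰⇒> x≰y)))

  offset-injective : ∀ {x y y′} → y < n → y′ < n → offset x y ≡ offset x y′ → y ≡ y′
  offset-injective {x} {y} {y′} y<n y′<n eq with x ≤? y | x ≤? y′
  ... | yes x≤y | yes x≤y′ = trans (sym (m+[n∸m]≡n x≤y))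
        (trans (cong (x +_) (trans (sym (offset-≤ x≤y)) (trans eq (offset-≤ x≤y′)))) (m+[n∸m]≡n x≤y′))
  ... | no x≰y | no x≰y′ = +-cancelʳ-≡ (n ∸ x) y y′
        (trans (sym (offset-> (≰⇒> x≰y))) (trans eq (offset-> (≰⇒> x≰y′))))
  ... | yes x≤y | no x≰y′ = contradiction (trans (sym (offset-≤ x≤y)) (trans eq (offset-> (≰⇒> x≰y′))))
        (<⇒≢ (≤-trans (∸-monoˡ-< y<n x≤y) (m≤n+m (n ∸ x) y′)))
  ... | no x≰y | yes x≤y′ = contradiction (trans (sym (offset-≤ x≤y′)) (trans (sym eq) (offset-> (≰⇒> x≰y))))
        (<⇒≢ (≤-trans (∸-monoˡ-< y′<n x≤y′) (m≤n+m (n ∸ x) y)))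

  offset-surjective : ∀ {x c} → x < n → c < n → ∃[ y ] y < n × offset x y ≡ c
  offset-surjective {x} {c} x<n c<n with x + c <? n
  ... | yes x+c<n = x + c , x+c<n , offset-+ x c
  ... | no x+c≮n with m≤n⇒∃[o]m+o≡n (≮⇒≥ x+c≮n) | m≤n⇒∃[o]m+o≡n (<⇒≤ x<n)
  ...   | y , n+y≡x+c | d , x+d≡n = y , y<n , trans (offset-> y<x) y+[n∸x]≡c
    where
    y<x : y < x
    y<x = +-cancelˡ-< n y x (subst (_< n + x) (sym n+y≡x+c)
            (subst (x + c <_) (+-comm x n) (+-monoʳ-< x c<n)))
    y<n : y < n
    y<n = <-trans y<x x<n
    y+[n∸x]≡c : y + (n ∸ x) ≡ c
    y+[n∸x]≡c = +-cancelˡ-≡ x _ _ (begin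
      x + (y + (n ∸ x)) ≡⟨ cong (λ t → x + (y + t)) (trans (cong (_∸ x) (sym x+d≡n)) (m+n∸m≡n x d)) ⟩
      x + (y + d)       ≡⟨ +-rearrange x y d ⟩
      (x + d) + y       ≡⟨ cong (_+ y) x+d≡n ⟩
      n + y             ≡⟨ n+y≡x+c ⟩
      x + c             ∎)
      where
      open ≡-Reasoning
      +-rearrange : ∀ a b c → a + (b + c) ≡ (a + c) + b
      +-rearrange = solve-∀

  count-offset : ∀ {x} → x < n → (P : ℕ → Bool) → count n (P ∘ offset x) ≡ count n P
  count-offset {x} x<n P with m≤n⇒∃[o]m+o≡n (<⇒≤ x<n)
  ... | d , refl = begin
    count (x + d) (P ∘ offset x)                              ≡⟨ count-+ x d _ ⟩
    count x (P ∘ offset x) + count d (λ i → P (offset x (x + i)))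
      ≡⟨ cong₂ _+_ (count-cong x (λ i i<x → cong P (trans (offset-> i<x) (cong (i +_) (m+n∸m≡n x d)))))
                   (count-cong d (λ i _ → cong P (offset-+ x i))) ⟩
    count x (λ i → P (i + d)) + count d P                     ≡⟨ +-comm _ (count d P) ⟩
    count d P + count x (λ i → P (i + d))                     ≡⟨ cong (count d P +_) (count-cong x (λ i _ → cong P (+-comm i d))) ⟩
    count d P + count x (λ i → P (d + i))                     ≡⟨ count-+ d x P ⟨
    count (d + x) P                                           ≡⟨ cong (λ t → count t P) (+-comm d x) ⟩
    count (x + d) P                                           ∎
    where open ≡-Reasoning

  offset-wraps : ∀ {x y z} → y < n → x ≤ y → z < x → ∣ offset x y - offset x z ∣ ≡ n ∸ ∣ y - z ∣
  offset-wraps {x} {y} {z} y<n x≤y z<x with m≤n⇒∃[o]m+o≡n x≤y | m≤n⇒∃[o]m+o≡n z<x | m≤n⇒∃[o]m+o≡n y<n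
  ... | a , refl | f , refl | g , refl = begin
    ∣ offset x y - offset x z ∣                   ≡⟨ cong₂ ∣_-_∣ (offset-+ x a) (offset-> z<x) ⟩
    ∣ a - z + (n ∸ x) ∣                          ≡⟨ cong (λ t → ∣ a - z + t ∣) n∸x≡ ⟩
    ∣ a - z + (a + suc g) ∣                      ≡⟨ cong (λ t → ∣ a - t ∣) (+-shuffle z a g) ⟩
    ∣ a - a + suc (z + g) ∣                      ≡⟨ ∣m-m+n∣≡n a (suc (z + g)) ⟩
    suc (z + g)                                  ≡⟨ m+n∸n≡m (suc (z + g)) (suc (f + a)) ⟨
    suc (z + g) + suc (f + a) ∸ suc (f + a)      ≡⟨ cong₂ _∸_ (n-split z f a g) (sym ∣y-z∣) ⟩
    n ∸ ∣ y - z ∣                                ∎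
    where
    open ≡-Reasoning
    n∸x≡ : n ∸ x ≡ a + suc g
    n∸x≡ = trans (cong (_∸ x) (n-from-x x a g)) (m+n∸m≡n x (a + suc g))
      where
      n-from-x : ∀ x a g → suc (x + a) + g ≡ x + (a + suc g)
      n-from-x = solve-∀
    +-shuffle : ∀ z a g → z + (a + suc g) ≡ a + suc (z + g)
    +-shuffle = solve-∀
    n-split : ∀ z f a g → suc (z + g) + suc (f + a) ≡ suc (suc z + f + a) + g
    n-split = solve-∀
    ∣y-z∣ : ∣ y - z ∣ ≡ suc (f + a)
    ∣y-z∣ = trans (cong (λ t → ∣ t - z ∣) (y-split z f a)) (trans (∣-∣-comm (z + suc (f + a)) z) (∣m-m+n∣≡n z (suc (f + a))))
      where
      y-split : ∀ z f a → suc z + f + a ≡ z + suc (f + a)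
      y-split = solve-∀

  offset-∣-∣ : ∀ x {y z} → y < n → z < n →
    ∣ offset x y - offset x z ∣ ≡ ∣ y - z ∣ ⊎ ∣ offset x y - offset x z ∣ ≡ n ∸ ∣ y - z ∣
  offset-∣-∣ x {y} {z} y<n z<n with x ≤? y | x ≤? z
  ... | yes x≤y | yes x≤z with m≤n⇒∃[o]m+o≡n x≤y | m≤n⇒∃[o]m+o≡n x≤z
  ...   | a , refl | b , refl =
    inj₁ (trans (cong₂ ∣_-_∣ (offset-+ x a) (offset-+ x b)) (sym (∣m+n-m+o∣≡∣n-o∣ x a b)))
  offset-∣-∣ x {y} {z} y<n z<n | no x≰y | no x≰z =
    inj₁ (trans (cong₂ ∣_-_∣ (trans (offset-> (≰⇒> x≰y)) (+-comm y _)) (trans (offset-> (≰⇒> x≰z)) (+-comm z _)))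
                (∣m+n-m+o∣≡∣n-o∣ (n ∸ x) y z))
  offset-∣-∣ x {y} {z} y<n z<n | yes x≤y | no x≰z = inj₂ (offset-wraps y<n x≤y (≰⇒> x≰z))
  offset-∣-∣ x {y} {z} y<n z<n | no x≰y | yes x≤z =
    inj₂ (trans (∣-∣-comm (offset x y) _) (trans (offset-wraps z<n x≤z (≰⇒> x≰y)) (cong (n ∸_) (∣-∣-comm z y))))

∣-∣≤⁺ : ∀ {x c k} → c ≤ x + k → x ≤ c + k → ∣ x - c ∣ ≤ k
∣-∣≤⁺ {x} {c} {k} c≤x+k x≤c+k with ≤-total x c
... | inj₁ x≤c = subst (_≤ k) (sym (m≤n⇒∣m-n∣≡n∸m x≤c)) (subst (c ∸ x ≤_) (m+n∸m≡n x k) (∸-monoˡ-≤ x c≤x+k))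
... | inj₂ c≤x = subst (_≤ k) (trans (sym (m≤n⇒∣m-n∣≡n∸m c≤x)) (∣-∣-comm c x))
                   (subst (x ∸ c ≤_) (m+n∸m≡n c k) (∸-monoˡ-≤ c x≤c+k))

∣-∣≤⁻ : ∀ {x c k} → ∣ x - c ∣ ≤ k → c ≤ x + k × x ≤ c + k
∣-∣≤⁻ {x} {c} {k} ∣x-c∣≤k =
  ≤-trans (m≤n+∣m-n∣ c x) (subst (_≤ x + k) refl (+-monoʳ-≤ x (subst (_≤ k) (∣-∣-comm x c) ∣x-c∣≤k))) ,
  ≤-trans (m≤n+∣m-n∣ x c) (+-monoʳ-≤ c ∣x-c∣≤k)

module Progression (k : ℕ) where

  q : ℕ
  q = suc (2 * k)

  progression : ℕ → ℕ → Bool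
  progression a c = (a ≤ᵇ c) ∧ ((c ∸ a) % q ≡ᵇ 0)

  progression-+ : ∀ a i → progression a (a + i) ≡ (i % q ≡ᵇ 0)
  progression-+ a i rewrite ≤ᵇ-true (m≤m+n a i) | m+n∸m≡n a i = refl

  progression-term : ∀ a j → progression a (a + j * q) ≡ true
  progression-term a j = trans (progression-+ a (j * q)) (cong (_≡ᵇ 0) (m*n%n≡0 j q))

  progression-self : ∀ a → progression a a ≡ true
  progression-self a = subst (λ c → progression a c ≡ true) (+-identityʳ a) (progression-+ a 0)

  progression-term⁻ : ∀ {a c} → progression a c ≡ true → ∃[ j ] c ≡ a + j * q
  progression-term⁻ {a} {c} eq with a ≤ᵇ c in a≤ᵇc | (c ∸ a) % q in r
  progression-term⁻ {a} {c} refl | true | zero = (c ∸ a) / q , (begin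
    c                                     ≡⟨ m+[n∸m]≡n (≤ᵇ-true⁻ {a} a≤ᵇc) ⟨
    a + (c ∸ a)                           ≡⟨ cong (a +_) (m≡m%n+[m/n]*n (c ∸ a) q) ⟩
    a + ((c ∸ a) % q + (c ∸ a) / q * q)   ≡⟨ cong (λ t → a + (t + (c ∸ a) / q * q)) r ⟩
    a + (c ∸ a) / q * q                   ∎)
    where open ≡-Reasoning

  progression-< : ∀ {a c} → c < a → progression a c ≡ false
  progression-< c<a rewrite ≤ᵇ-false c<a = refl

  progression-% : ∀ {a c} → progression a c ≡ true → c % q ≡ a % q
  progression-% {a} {c} eq with progression-term⁻ {a} {c} eq
  ... | j , refl = [m+kn]%n≡m%n a j q

  count-progression : ∀ a J → count (a + J * q) (progression a) ≡ J
  count-progression a J = begin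
    count (a + J * q) (progression a)
      ≡⟨ count-+ a (J * q) _ ⟩
    count a (progression a) + count (J * q) (λ i → progression a (a + i))
      ≡⟨ cong₂ _+_ (count-false a (λ _ i<a → progression-< i<a)) (count-cong (J * q) (λ i _ → progression-+ a i)) ⟩
    count (J * q) multiple
      ≡⟨ count-multiples J ⟩
    J ∎
    where
    open ≡-Reasoning
    multiple : ℕ → Bool
    multiple i = i % q ≡ᵇ 0
    count-multiples : ∀ J → count (J * q) multiple ≡ J
    count-multiples zero = refl
    count-multiples (suc J) = begin
      count (q + J * q) multiple                                 ≡⟨ count-+ q (J * q) multiple ⟩
      count q multiple + count (J * q) (λ i → multiple (q + i))  ≡⟨ cong₂ _+_ first-period shift ⟩
      1 + count (J * q) multiple                                 ≡⟨ cong suc (count-multiples J) ⟩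
      suc J                                                      ∎
      where
      first-period : count q multiple ≡ 1
      first-period = cong suc (count-false (2 * k) (λ i i<2k → cong (_≡ᵇ 0) (m<n⇒m%n≡m (s≤s i<2k))))
      shift : count (J * q) (λ i → multiple (q + i)) ≡ count (J * q) multiple
      shift = count-cong (J * q) (λ i _ → cong (_≡ᵇ 0) (trans (cong (_% q) (+-comm q i)) ([m+n]%n≡m%n i q)))

  nearest-term : ∀ {a x} J → a ≤ x + k → x + k < a + suc J * q → ∃[ j ] j ≤ J × ∣ x - (a + j * q) ∣ ≤ k
  nearest-term {a} {x} J a≤x+k x+k<end = j , j≤J , ∣-∣≤⁺ lo hi
    where
    t = x + k ∸ a
    j = t / q
    r = t % q
    x+k≡ : x + k ≡ a + (r + j * q)
    x+k≡ = trans (sym (m+[n∸m]≡n a≤x+k)) (cong (a +_) (m≡m%n+[m/n]*n t q))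
    lo : a + j * q ≤ x + k
    lo = subst (a + j * q ≤_) (sym x+k≡) (+-monoʳ-≤ a (m≤n+m (j * q) r))
    hi : x ≤ a + j * q + k
    hi = +-cancelʳ-≤ k x _ (begin
      x + k               ≡⟨ x+k≡ ⟩
      a + (r + j * q)     ≤⟨ +-monoʳ-≤ a (+-monoˡ-≤ (j * q) r≤2k) ⟩
      a + (2 * k + j * q) ≡⟨ +-rearrange a k (j * q) ⟩
      a + j * q + k + k   ∎)
      where
      open ≤-Reasoning
      r≤2k : r ≤ 2 * k
      r≤2k = s≤s⁻¹ (m%n<n t q)
      +-rearrange : ∀ a k w → a + (2 * k + w) ≡ a + w + k + k
      +-rearrange = solve-∀
    j≤J : j ≤ J
    j≤J = s≤s⁻¹ (*-cancelʳ-< q j (suc J) (≤-<-trans (m/n*n≤m t q)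
            (+-cancelˡ-< a t _ (subst (_< a + suc J * q) (sym (m+[n∸m]≡n a≤x+k)) x+k<end))))

  -- Induction from the left: the first point out of reach of the centre k + 1 + j q forces the next one.
  forced-terms : ∀ m (C : ℕ → Set) → (∀ {c} → C c → k < c) →
    (∀ {a} → 1 ≤ a → a ≤ m * q → ∃[ c ] C c × ∣ a - c ∣ ≤ k) →
    (∀ {a c c′} → 1 ≤ a → a ≤ m * q → C c → C c′ → ∣ a - c ∣ ≤ k → ∣ a - c′ ∣ ≤ k → c ≡ c′) →
    ∀ j → j < m → C (suc k + j * q)
  forced-terms m C k<c covered unique = forced
    where
    forced : ∀ j → j < m → C (suc k + j * q)
    forced zero 0<m with covered ≤-refl (≤-trans (s≤s z≤n) (*-monoˡ-≤ q 0<m))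
    ... | c , Cc , ∣1-c∣≤k = subst C c≡k+1 Cc
      where
      c≡k+1 : c ≡ suc k + 0
      c≡k+1 = trans (≤-antisym (proj₁ (∣-∣≤⁻ ∣1-c∣≤k)) (k<c Cc)) (sym (+-identityʳ (suc k)))
    forced (suc j) j+1<m = step (covered (s≤s z≤n) (≤-trans (+-monoˡ-≤ b (s≤s z≤n)) (*-monoˡ-≤ q j+1<m)))
      where
      b = suc j * q
      c = suc k + j * q
      b≡c+k : b ≡ c + k
      b≡c+k = period j k
        where
        period : ∀ j k → suc j * suc (2 * k) ≡ suc k + j * suc (2 * k) + k
        period = solve-∀
      previous : C c
      previous = forced j (<-trans (n<1+n j) j+1<m)
      ∣b-c∣≤k : ∣ b - c ∣ ≤ k
      ∣b-c∣≤k = ∣-∣≤⁺ (≤-trans (m≤m+n c k) (≤-trans (≤-reflexive (sym b≡c+k)) (m≤m+n b k))) (≤-reflexive b≡c+k)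
      step : ∃[ c′ ] C c′ × ∣ suc b - c′ ∣ ≤ k → C (suc k + b)
      step (c′ , Cc′ , ∣a-c′∣≤k) with ∣-∣≤⁻ ∣a-c′∣≤k | c′ ≤? b + k
      ... | c′≤a+k , _ | no c′≰b+k =
        subst C (≤-antisym (≤-trans c′≤a+k (≤-reflexive (cong suc (+-comm b k))))
                           (subst (_≤ c′) (cong suc (+-comm b k)) (≰⇒> c′≰b+k))) Cc′
      ... | _ , a≤c′+k | yes c′≤b+k =
        contradiction (unique (s≤s z≤n) (*-monoˡ-≤ q (<⇒≤ j+1<m)) previous Cc′ ∣b-c∣≤k ∣b-c′∣≤k) c≢c′
        where
        ∣b-c′∣≤k : ∣ b - c′ ∣ ≤ k
        ∣b-c′∣≤k = ∣-∣≤⁺ c′≤b+k (≤-trans (n≤1+n b) a≤c′+k)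
        c≢c′ : c ≢ c′
        c≢c′ c≡c′ = <-irrefl refl
          (≤-trans (s≤s (≤-reflexive (trans (cong (_+ k) (sym c≡c′)) (sym b≡c+k)))) a≤c′+k)

T-ext : ∀ {a b} → (T a → T b) → (T b → T a) → a ≡ b
T-ext {true} {true} _ _ = refl
T-ext {true} {false} a⇒b _ = contradiction (a⇒b _) λ ()
T-ext {false} {true} _ b⇒a = contradiction (b⇒a _) λ ()
T-ext {false} {false} _ _ = refl

∈-oneTo⁻ : ∀ k {d} → T (any (d ≡ᵇ_) (oneTo k)) → 1 ≤ d × d ≤ k
∈-oneTo⁻ k {d} t with ∈-map⁻ suc (Any.map (λ {x} → ≡ᵇ⇒≡ d x) (any⁻ _ (oneTo k) t))
... | x , x∈upTo , refl = s≤s z≤n , ∈-upTo⁻ x∈upTo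

any-oneTo : ∀ k {d} → 1 ≤ d → any (d ≡ᵇ_) (oneTo k) ≡ (d ≤ᵇ k)
any-oneTo k {suc d} _ = T-ext (λ t → ≤⇒≤ᵇ (proj₂ (∈-oneTo⁻ k t)))
  (λ t → any⁺ _ (Any.map (λ {x} → ≡⇒≡ᵇ (suc d) x) (∈-map⁺ suc (∈-upTo⁺ (≤ᵇ⇒≤ (suc d) k t)))))

any-oneTo-0 : ∀ k → any (0 ≡ᵇ_) (oneTo k) ≡ false
any-oneTo-0 k = T-ext (λ t → contradiction (proj₁ (∈-oneTo⁻ k {0} t)) λ ()) λ ()

module Circulant (n k : ℕ) (1≤k : 1 ≤ k) (2k<n : 2 * k < n) where

  open Progression k public
  open Offset n public

  G : Graph n
  G = C n k

  near : ℕ → Bool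
  near d = (d ≤ᵇ k) ∨ (n ∸ d ≤ᵇ k)

  k<n : k < n
  k<n = ≤-<-trans (m≤m+n k (k + 0)) 2k<n

  2<n : 2 < n
  2<n = ≤-trans (s≤s (*-monoʳ-≤ 2 1≤k)) 2k<n

  1<n : 1 < n
  1<n = <-trans (n<1+n 1) 2<n

  v₀ v₁ : Fin n
  v₀ = fromℕ< (<-trans (s≤s z≤n) 1<n)
  v₁ = fromℕ< 1<n

  C-sym : ∀ u w → G u w ≡ G w u
  C-sym u w = cong (λ d → any (d ≡ᵇ_) (oneTo k) ∨ any ((n ∸ d) ≡ᵇ_) (oneTo k)) (∣-∣-comm (toℕ u) (toℕ w))

  C-irreflexive : ∀ v → G v v ≡ false
  C-irreflexive v rewrite ∣n-n∣≡0 (toℕ v) =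
    cong₂ _∨_ (any-oneTo-0 k) (trans (any-oneTo k (<-≤-trans (s≤s z≤n) k<n)) (≤ᵇ-false k<n))

  ∣u-w∣<n : ∀ (u w : Fin n) → ∣ toℕ u - toℕ w ∣ < n
  ∣u-w∣<n u w = ≤-<-trans (∣m-n∣≤m⊔n (toℕ u) (toℕ w)) (⊔-lub (toℕ<n u) (toℕ<n w))

  C-near : ∀ {u w} → u ≢ w → G u w ≡ near ∣ toℕ u - toℕ w ∣
  C-near {u} {w} u≢w = cong₂ _∨_ (any-oneTo k 1≤d) (any-oneTo k (m<n⇒0<n∸m (∣u-w∣<n u w)))
    where
    1≤d : 1 ≤ ∣ toℕ u - toℕ w ∣
    1≤d with ∣ toℕ u - toℕ w ∣ in eq
    ... | zero = contradiction (toℕ-injective (∣m-n∣≡0⇒m≡n eq)) u≢w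
    ... | suc _ = s≤s z≤n

  closed-near : ∀ u w → lookup (N[_] G u) w ≡ near ∣ toℕ u - toℕ w ∣
  closed-near u w = trans (lookup∘tabulate _ w) (by-cases (u ≟ w))
    where
    by-cases : (u≟w : Dec (u ≡ w)) → does u≟w ∨ G u w ≡ near ∣ toℕ u - toℕ w ∣
    by-cases (yes refl) = cong near (sym (∣n-n∣≡0 (toℕ u)))
    by-cases (no u≢w) = C-near u≢w

  near-flip : ∀ {d} → d ≤ n → near (n ∸ d) ≡ near d
  near-flip {d} d≤n rewrite m∸[m∸n]≡n d≤n = ∨-comm (n ∸ d ≤ᵇ k) (d ≤ᵇ k)

  near-≤ : ∀ {d} → d ≤ k → near d ≡ true
  near-≤ {d} d≤k = cong (_∨ (n ∸ d ≤ᵇ k)) (≤ᵇ-true d≤k)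

  pos : Fin n → Fin n → ℕ
  pos v w = offset (toℕ v) (toℕ w)

  pos<n : ∀ v w → pos v w < n
  pos<n v w = offset-<n (toℕ<n v) (toℕ<n w)

  pos-self : ∀ v → pos v v ≡ 0
  pos-self v = offset-self (toℕ v)

  pos-injective : ∀ v {w w′} → pos v w ≡ pos v w′ → w ≡ w′
  pos-injective v {w} {w′} eq = toℕ-injective (offset-injective {toℕ v} (toℕ<n w) (toℕ<n w′) eq)

  vertex-at : ∀ v {c} → c < n → ∃[ w ] pos v w ≡ c
  vertex-at v c<n with offset-surjective (toℕ<n v) c<n
  ... | y , y<n , eq = fromℕ< y<n , trans (cong (offset (toℕ v)) (toℕ-fromℕ< y<n)) eq

  closed-pos : ∀ v u w → lookup (N[_] G u) w ≡ near ∣ pos v u - pos v w ∣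
  closed-pos v u w with offset-∣-∣ (toℕ v) (toℕ<n u) (toℕ<n w)
  ... | inj₁ eq = trans (closed-near u w) (cong near (sym eq))
  ... | inj₂ eq = trans (closed-near u w) (trans (sym (near-flip (<⇒≤ (∣u-w∣<n u w)))) (cong near (sym eq)))

  S : Fin n → (ℕ → Bool) → Subset n
  S v P = tabulate (P ∘ pos v)

  ∈S⁺ : ∀ v P {w} → P (pos v w) ≡ true → w ∈ S v P
  ∈S⁺ v P {w} eq = lookup⇒[]= w (S v P) (trans (lookup∘tabulate _ w) eq)

  ∈S⁻ : ∀ v P {w} → w ∈ S v P → P (pos v w) ≡ true
  ∈S⁻ v P {w} w∈S = trans (sym (lookup∘tabulate _ w)) ([]=⇒lookup w∈S)

  S-pointwise : ∀ v {P Q} → S v P ≡ S v Q → ∀ {c} → c < n → P c ≡ Q c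
  S-pointwise v {P} {Q} S≡ c<n with vertex-at v c<n
  ... | w , refl = begin
    P (pos v w)          ≡⟨ lookup∘tabulate _ w ⟨
    lookup (S v P) w     ≡⟨ cong (λ p → lookup p w) S≡ ⟩
    lookup (S v Q) w     ≡⟨ lookup∘tabulate _ w ⟩
    Q (pos v w)          ∎
    where open ≡-Reasoning

  ∣S∣≡count : ∀ v P → ∣ S v P ∣ ≡ count n P
  ∣S∣≡count v P = trans (∣tabulate∣≡count n (P ∘ offset (toℕ v))) (count-offset (toℕ<n v) P)

  N[]≡S-near : ∀ u → N[_] G u ≡ S u near
  N[]≡S-near u = trans (sym (tabulate∘lookup (N[_] G u))) (tabulate-cong λ w →
    trans (closed-pos u u w) (cong (λ x → near ∣ x - pos u w ∣) (pos-self u)))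

  count-near : count n near ≡ q
  count-near with m≤n⇒∃[o]m+o≡n 2k<n
  ... | t , refl = begin
    count (suc (2 * k) + t) near
      ≡⟨ cong (λ m → count m near) n≡ ⟩
    count (suc k + (t + k)) near
      ≡⟨ count-+ (suc k) (t + k) near ⟩
    count (suc k) near + count (t + k) (λ i → near (suc k + i))
      ≡⟨ cong (count (suc k) near +_) (count-+ t k _) ⟩
    count (suc k) near + (count t (λ i → near (suc k + i)) + count k (λ i → near (suc k + (t + i))))
      ≡⟨ cong₂ _+_ (count-true (suc k) (λ i i≤k → near-≤ (s≤s⁻¹ i≤k)))
                   (cong₂ _+_ (count-false t far) (count-true k (λ i i<k → close-to-n i))) ⟩
    suc k + (0 + k)
      ≡⟨ sizes k ⟩
    q ∎
    where
    open ≡-Reasoning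
    n≡ : suc (2 * k) + t ≡ suc k + (t + k)
    n≡ = split k t
      where
      split : ∀ k t → suc (2 * k) + t ≡ suc k + (t + k)
      split = solve-∀
    sizes : ∀ k → suc k + (0 + k) ≡ suc (2 * k)
    sizes = solve-∀
    n∸ : ∀ i → suc (2 * k) + t ∸ (suc k + i) ≡ t + k ∸ i
    n∸ i = trans (cong (_∸ (suc k + i)) n≡) ([m+n]∸[m+o]≡n∸o (suc k) (t + k) i)
    far : ∀ i → i < t → near (suc k + i) ≡ false
    far i i<t = cong₂ _∨_ (≤ᵇ-false (m≤m+n (suc k) i)) (trans (cong (_≤ᵇ k) (n∸ i)) (≤ᵇ-false k<t+k∸i))
      where
      k<t+k∸i : k < t + k ∸ i
      k<t+k∸i = subst (k <_) (sym (+-∸-comm k (<⇒≤ i<t))) (+-monoˡ-≤ k (m<n⇒0<n∸m i<t))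
    close-to-n : ∀ i → near (suc k + (t + i)) ≡ true
    close-to-n i = trans (cong ((suc k + (t + i) ≤ᵇ k) ∨_)
      (trans (cong (_≤ᵇ k) (trans (n∸ (t + i)) ([m+n]∸[m+o]≡n∸o t k i))) (≤ᵇ-true (m∸n≤m k i)))) (∨-zeroʳ _)

  ∣N[]∣≡q : ∀ u → ∣ N[_] G u ∣ ≡ q
  ∣N[]∣≡q u = trans (cong ∣_∣ (N[]≡S-near u)) (trans (∣S∣≡count u near) count-near)

  degree≡2k : ∀ v → degree G v ≡ 2 * k
  degree≡2k v = suc-injective (trans (sym (∣N[]∣≡suc-degree G v (C-irreflexive v))) (∣N[]∣≡q v))

  open Regular G C-sym q ∣N[]∣≡q public

  Covers : (ℕ → Bool) → Set
  Covers P = ∀ {a} → 1 ≤ a → a < n → ∃[ c ] c < n × P c ≡ true × ∣ a - c ∣ ≤ k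

  ∈∁⁅⁆⁺ : ∀ {u v : Fin n} → u ≢ v → u ∈ ∁ ⁅ v ⁆
  ∈∁⁅⁆⁺ u≢v = x∉p⇒x∈∁p (x≢y⇒x∉⁅y⁆ u≢v)

  ∈∁⁅⁆⁻ : ∀ {u v : Fin n} → u ∈ ∁ ⁅ v ⁆ → u ≢ v
  ∈∁⁅⁆⁻ {v = v} u∈ refl = x∈∁p⇒x∉p u∈ (x∈⁅x⁆ v)

  ∣∁⁅⁆∣ : ∀ (v : Fin n) → ∣ ∁ ⁅ v ⁆ ∣ ≡ n ∸ 1
  ∣∁⁅⁆∣ v = trans (∣∁p∣≡n∸∣p∣ ⁅ v ⁆) (cong (n ∸_) (∣⁅x⁆∣≡1 v))

  1≤pos : ∀ {v u} → u ≢ v → 1 ≤ pos v u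
  1≤pos {v} {u} u≢v with pos v u in eq
  ... | zero = contradiction (pos-injective v (trans eq (sym (pos-self v)))) u≢v
  ... | suc _ = s≤s z≤n

  covered-vertex : ∀ {v P} → Covers P → ∀ {u} → u ≢ v → ∃[ w ] w ∈ S v P × w ∈ N[_] G u
  covered-vertex {v} {P} covers {u} u≢v with covers (1≤pos u≢v) (pos<n v u)
  ... | c , c<n , Pc , ∣a-c∣≤k with vertex-at v c<n
  ...   | w , refl = w , ∈S⁺ v P Pc , lookup⇒[]= w (N[_] G u) (trans (closed-pos v u w) (near-≤ ∣a-c∣≤k))

  adjacent : ∀ {u w} → w ∈ N[_] G u → u ≢ w → G u w ≡ true
  adjacent {u} {w} w∈N[u] u≢w =
    trans (sym (cong (_∨ G u w) (dec-false (u ≟ w) u≢w))) (trans (sym (lookup∘tabulate _ w)) ([]=⇒lookup w∈N[u]))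

  dominates-off : ∀ {v P} → Covers P → ∀ {u} → u ≢ v → u ∉ S v P → ∃[ w ] w ∈ S v P × G u w ≡ true
  dominates-off {v} {P} covers {u} u≢v u∉S with covered-vertex {v} {P} covers u≢v
  ... | w , w∈S , w∈N[u] = w , w∈S , adjacent {u} w∈N[u] (λ { refl → u∉S w∈S })

  S-dominates-∁ : ∀ v P → P 0 ≡ false → Covers P → IsDominating G (∁ ⁅ v ⁆) (S v P)
  S-dominates-∁ v P P0≡false covers = S⊆ , λ u u∈ → dominates-off {v} {P} covers (∈∁⁅⁆⁻ u∈)
    where
    S⊆ : S v P ⊆ ∁ ⁅ v ⁆
    S⊆ {w} w∈S = ∈∁⁅⁆⁺ λ { refl →
      contradiction (trans (sym P0≡false) (trans (cong P (sym (pos-self v))) (∈S⁻ v P w∈S))) λ () }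

  S-dominates-⊤ : ∀ v P → P 0 ≡ true → Covers P → IsDominating G ⊤ (S v P)
  S-dominates-⊤ v P P0≡true covers = ⊆⊤ , λ u _ u∉S → dominates-off {v} {P} covers (λ { refl → u∉S v∈S }) u∉S
    where
    v∈S : v ∈ S v P
    v∈S = ∈S⁺ v P (trans (cong P (pos-self v)) P0≡true)

  progression-covers-below : ∀ {a} J {L} → 1 ≤ a → a ≤ suc k → a + J * q < n → L + k ≤ a + suc J * q →
    ∀ {x} → 1 ≤ x → x < L → ∃[ c ] c < n × progression a c ≡ true × ∣ x - c ∣ ≤ k
  progression-covers-below {a} J 1≤a a≤k+1 last<n L+k≤end {x} 1≤x x<L
    with nearest-term J (≤-trans a≤k+1 (+-monoˡ-≤ k 1≤x)) (<-≤-trans (+-monoˡ-< k x<L) L+k≤end)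
  ... | j , j≤J , ∣x-c∣≤k =
    a + j * q , ≤-<-trans (+-monoʳ-≤ a (*-monoˡ-≤ q j≤J)) last<n , progression-term a j , ∣x-c∣≤k

  progression-covers : ∀ {a} J → 1 ≤ a → a ≤ suc k → a + J * q < n → n + k ≤ a + suc J * q → Covers (progression a)
  progression-covers {a} J = progression-covers-below {a} J {n}

  near⁻ : ∀ {d} → near d ≡ true → d + k < n → d ≤ k
  near⁻ {d} near-d d+k<n with d ≤ᵇ k in d≤ᵇk
  ... | true = ≤ᵇ-true⁻ {d} d≤ᵇk
  ... | false = contradiction (≤-trans (m≤n+m∸n n d) (+-monoʳ-≤ d (≤ᵇ-true⁻ near-d))) (<⇒≱ d+k<n)

  -- Away from the removed vertex, cyclic closeness is closeness on the line.
  near⇒∣-∣≤ : ∀ {a c} → a < n → k < c → c + k < n → near ∣ a - c ∣ ≡ true → ∣ a - c ∣ ≤ k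
  near⇒∣-∣≤ {a} {c} a<n k<c c+k<n near-d = near⁻ near-d d+k<n
    where
    d+k<n : ∣ a - c ∣ + k < n
    d+k<n with ≤-total a c
    ... | inj₁ a≤c = subst (λ d → d + k < n) (sym (m≤n⇒∣m-n∣≡n∸m a≤c))
                      (≤-<-trans (+-monoˡ-≤ k (m∸n≤m c a)) c+k<n)
    ... | inj₂ c≤a = subst (λ d → d + k < n) (sym (trans (∣-∣-comm a c) (m≤n⇒∣m-n∣≡n∸m c≤a)))
                      (<-trans (subst (a ∸ c + k <_) (m∸n+n≡m c≤a) (+-monoʳ-< (a ∸ c) k<c)) a<n)

  near-false⁻ : ∀ {d} → near d ≡ false → d < n → k < d × d + k < n
  near-false⁻ {d} far d<n with d ≤ᵇ k in d≤ᵇk | n ∸ d ≤ᵇ k in n∸d≤ᵇk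
  near-false⁻ {d} refl d<n | false | false =
    ≤ᵇ-false⁻ {d} d≤ᵇk ,
    subst (d + k <_) (m+[n∸m]≡n (<⇒≤ d<n)) (+-monoʳ-< d (≤ᵇ-false⁻ {n ∸ d} n∸d≤ᵇk))

  Covers-∨ : ∀ {P} (Q : ℕ → Bool) → Covers P → Covers (λ y → P y ∨ Q y)
  Covers-∨ {P} Q covers 1≤a a<n with covers 1≤a a<n
  ... | c , c<n , Pc , ∣a-c∣≤k = c , c<n , cong (_∨ Q c) Pc , ∣a-c∣≤k

  punctured-bound : ∀ {v D} → IsDominating G (∁ ⁅ v ⁆) D → n ∸ 1 ≤ ∣ D ∣ * q
  punctured-bound {v} D-dom = subst (_≤ _) (∣∁⁅⁆∣ v) (domination-bound D-dom)

  module Divisible (t : ℕ) (n≡ : n ≡ suc (suc t * q)) where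

    m : ℕ
    m = suc t

    centres : ℕ → Bool
    centres = progression (suc k)

    centres₀ : ℕ → Bool
    centres₀ y = centres y ∨ (y ≡ᵇ 0)

    D E : Fin n → Subset n
    D v = S v centres
    E v = S v centres₀

    k+1<q : suc k < q
    k+1<q = s≤s (subst (_≤ 2 * k) (+-comm k 1) (+-monoʳ-≤ k (≤-trans 1≤k (m≤m+n k 0))))

    centres-cover : Covers centres
    centres-cover = progression-covers t (s≤s z≤n) ≤-refl last<n n+k≤
      where
      last<n : suc k + t * q < n
      last<n = subst (suc k + t * q <_) (sym n≡) (s≤s (+-monoˡ-≤ (t * q) (<⇒≤ k+1<q)))
      n+k≤ : n + k ≤ suc k + m * q
      n+k≤ = ≤-reflexive (trans (cong (_+ k) n≡) (cong suc (+-comm (m * q) k)))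

    count-centres : count n centres ≤ m
    count-centres = ≤-trans (count-mono centres n≤) (≤-reflexive (count-progression (suc k) m))
      where
      n≤ : n ≤ suc k + m * q
      n≤ = subst (_≤ suc k + m * q) (sym n≡) (s≤s (m≤n+m (m * q) k))

    ∣∁⁅⁆∣≡mq : ∀ v → ∣ ∁ ⁅ v ⁆ ∣ ≡ m * q
    ∣∁⁅⁆∣≡mq v = trans (∣∁⁅⁆∣ v) (cong (_∸ 1) n≡)

    D-dominates : ∀ v → IsDominating G (∁ ⁅ v ⁆) (D v)
    D-dominates v = S-dominates-∁ v centres (progression-< {suc k} (s≤s z≤n)) centres-cover

    ∣D∣≤m : ∀ v → ∣ D v ∣ ≤ m
    ∣D∣≤m v = ≤-trans (≤-reflexive (∣S∣≡count v centres)) count-centres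

    m≤∣∣ : ∀ {v D′} → IsDominating G (∁ ⁅ v ⁆) D′ → m ≤ ∣ D′ ∣
    m≤∣∣ {v} {D′} D′-dom =
      *-cancelʳ-≤ m ∣ D′ ∣ q (subst (_≤ ∣ D′ ∣ * q) (∣∁⁅⁆∣≡mq v) (domination-bound D′-dom))

    D-γ : ∀ v → IsGammaSet G (∁ ⁅ v ⁆) (D v)
    D-γ v = D-dominates v , λ D′ D′-dom → ≤-trans (∣D∣≤m v) (m≤∣∣ D′-dom)

    D-EDS : ∀ v → IsEDS G (∁ ⁅ v ⁆) (D v)
    D-EDS v = proj₁ (D-dominates v) , λ u u∈ → proj₁ (tight-domination (D-dominates v) tight) u∈
      where
      tight : ∣ D v ∣ * q ≤ ∣ ∁ ⁅ v ⁆ ∣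
      tight = ≤-trans (*-monoˡ-≤ q (∣D∣≤m v)) (≤-reflexive (sym (∣∁⁅⁆∣≡mq v)))

    E-dominates : ∀ v → IsDominating G ⊤ (E v)
    E-dominates v = S-dominates-⊤ v centres₀ (∨-zeroʳ (centres 0)) (Covers-∨ (_≡ᵇ 0) centres-cover)

    ∣E∣≤m+1 : ∀ v → ∣ E v ∣ ≤ suc m
    ∣E∣≤m+1 v = begin
      ∣ E v ∣              ≡⟨ ∣S∣≡count v centres₀ ⟩
      count n centres₀     ≤⟨ count-∨-≡ᵇ n 0 centres ⟩
      count n centres + 1  ≤⟨ +-monoˡ-≤ 1 count-centres ⟩
      m + 1                ≡⟨ +-comm m 1 ⟩
      suc m                ∎
      where open ≤-Reasoning

    m<∣∣ : ∀ {D′} → IsDominating G ⊤ D′ → m < ∣ D′ ∣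
    m<∣∣ {D′} D′-dom = *-cancelʳ-< q m ∣ D′ ∣
      (subst (_≤ ∣ D′ ∣ * q) (trans (∣⊤∣≡n n) n≡) (domination-bound D′-dom))

    E-γ : ∀ v → IsGammaSet G ⊤ (E v)
    E-γ v = E-dominates v , λ D′ D′-dom → ≤-trans (∣E∣≤m+1 v) (m<∣∣ D′-dom)

    γ≡m+1 : ∀ {g} → IsDominationNumber G ⊤ g → g ≡ suc m
    γ≡m+1 {g} (D′ , (D′-dom , minimal) , refl) =
      ≤-antisym (≤-trans (minimal (E v₀) (E-dominates v₀)) (∣E∣≤m+1 v₀)) (m<∣∣ D′-dom)

    pos-v₁-v₀ : pos v₁ v₀ ≡ m * q
    pos-v₁-v₀ = begin
      offset (toℕ v₁) (toℕ v₀)  ≡⟨ cong₂ offset (toℕ-fromℕ< 1<n) (toℕ-fromℕ< _) ⟩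
      offset 1 0                ≡⟨ offset-> (s≤s z≤n) ⟩
      n ∸ 1                     ≡⟨ cong (_∸ 1) n≡ ⟩
      m * q                     ∎
      where open ≡-Reasoning

    centres-mq : centres (m * q) ≡ false
    centres-mq with centres (m * q) in eq
    ... | false = refl
    ... | true = contradiction (trans (sym (m*n%n≡0 m q)) (trans (progression-% {suc k} {m * q} eq) (m<n⇒m%n≡m k+1<q))) λ ()

    E-distinct : E v₀ ≢ E v₁
    E-distinct E≡ = contradiction (trans (sym not-in) (∈S⁻ v₁ centres₀ (subst (v₀ ∈_) E≡ v₀∈E))) λ ()
      where
      v₀∈E : v₀ ∈ E v₀
      v₀∈E = ∈S⁺ v₀ centres₀ (trans (cong centres₀ (pos-self v₀)) (∨-zeroʳ (centres 0)))
      not-in : centres₀ (pos v₁ v₀) ≡ false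
      not-in rewrite pos-v₁-v₀ = cong (_∨ (m * q ≡ᵇ 0)) centres-mq

    no-EDS : ¬ HasEDS G ⊤
    no-EDS (D′ , D′-EDS) = contradiction (begin
      1                   ≡⟨ m<n⇒m%n≡m (≤-trans (s≤s 1≤k) (<⇒≤ k+1<q)) ⟨
      1 % q               ≡⟨ [m+kn]%n≡m%n 1 m q ⟨
      suc (m * q) % q     ≡⟨ cong (_% q) (trans (sym n≡) (EDS⇒n≡∣D∣*q D′-EDS)) ⟩
      ∣ D′ ∣ * q % q      ≡⟨ m*n%n≡0 ∣ D′ ∣ q ⟩
      0                   ∎) λ ()
      where open ≡-Reasoning

    vertex-in-∁ : ∀ v {a} → 1 ≤ a → a < n → ∃[ u ] u ∈ ∁ ⁅ v ⁆ × pos v u ≡ a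
    vertex-in-∁ v 1≤a a<n with vertex-at v a<n
    ... | u , refl = u , ∈∁⁅⁆⁺ (λ { refl → contradiction (pos-self v) (>⇒≢ 1≤a) }) , refl

    within-k⇒∈N[] : ∀ v {u w} → ∣ pos v u - pos v w ∣ ≤ k → w ∈ N[_] G u
    within-k⇒∈N[] v {u} {w} d≤k = lookup⇒[]= w (N[_] G u) (trans (closed-pos v u w) (near-≤ d≤k))

    -- A γ-set D′ of G - v is efficient and keeps away from v, so its positions form an
    -- efficient cover of 1 … m q by intervals of radius k; these are forced to be those of D v.
    module Minimum (v : Fin n) {D′ : Subset n} (D′-γ : IsGammaSet G (∁ ⁅ v ⁆) D′) where

      ∣D′∣≤∣D∣ : ∣ D′ ∣ ≤ ∣ D v ∣
      ∣D′∣≤∣D∣ = proj₂ D′-γ (D v) (D-dominates v)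

      tight : (∀ {u} → u ∈ ∁ ⁅ v ⁆ → ∣ N[_] G u ∩ D′ ∣ ≡ 1) × (∀ {w} → w ∈ D′ → N[_] G w ⊆ ∁ ⁅ v ⁆)
      tight = tight-domination (proj₁ D′-γ)
        (≤-trans (*-monoˡ-≤ q (≤-trans ∣D′∣≤∣D∣ (∣D∣≤m v))) (≤-reflexive (sym (∣∁⁅⁆∣≡mq v))))

      Centre : ℕ → Set
      Centre c = ∃[ w ] w ∈ D′ × pos v w ≡ c

      centre-far : ∀ {w} → w ∈ D′ → k < pos v w × pos v w + k < n
      centre-far {w} w∈D′ = near-false⁻ far (pos<n v w)
        where
        far : near (pos v w) ≡ false
        far with near (pos v w) in eq
        ... | false = refl
        ... | true = contradiction (proj₂ tight w∈D′ v∈N[w]) (λ v∈∁ → ∈∁⁅⁆⁻ v∈∁ refl)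
          where
          v∈N[w] : v ∈ N[_] G w
          v∈N[w] = lookup⇒[]= v (N[_] G w) (begin
            lookup (N[_] G w) v         ≡⟨ closed-pos v w v ⟩
            near ∣ pos v w - pos v v ∣  ≡⟨ cong (λ x → near ∣ pos v w - x ∣) (pos-self v) ⟩
            near ∣ pos v w - 0 ∣        ≡⟨ cong near (∣-∣-identityʳ (pos v w)) ⟩
            near (pos v w)              ≡⟨ eq ⟩
            true                        ∎)
            where open ≡-Reasoning

      covered : ∀ {a} → 1 ≤ a → a ≤ m * q → ∃[ c ] Centre c × ∣ a - c ∣ ≤ k
      covered 1≤a a≤mq with vertex-in-∁ v 1≤a (subst (_ <_) (sym n≡) (s≤s a≤mq))
      ... | u , u∈∁ , refl with dominator G (proj₁ D′-γ) u∈∁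
      ...   | w , w∈D′ , w∈N[u] = pos v w , (w , w∈D′ , refl) ,
              near⇒∣-∣≤ (pos<n v u) (proj₁ (centre-far w∈D′)) (proj₂ (centre-far w∈D′))
                (trans (sym (closed-pos v u w)) ([]=⇒lookup w∈N[u]))

      unique : ∀ {a c c′} → 1 ≤ a → a ≤ m * q → Centre c → Centre c′ →
        ∣ a - c ∣ ≤ k → ∣ a - c′ ∣ ≤ k → c ≡ c′
      unique 1≤a a≤mq (w , w∈D′ , refl) (w′ , w′∈D′ , refl) d≤k d′≤k
        with vertex-in-∁ v 1≤a (subst (_ <_) (sym n≡) (s≤s a≤mq))
      ... | u , u∈∁ , refl = cong (pos v) (∣p∣≡1-unique (proj₁ tight u∈∁)
              (x∈p∩q⁺ (within-k⇒∈N[] v d≤k , w∈D′)) (x∈p∩q⁺ (within-k⇒∈N[] v d′≤k , w′∈D′)))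

      D⊆D′ : D v ⊆ D′
      D⊆D′ {w} w∈D with progression-term⁻ {suc k} (∈S⁻ v centres w∈D)
      ... | j , pos≡ with forced-terms m Centre (λ { (w , w∈D′ , refl) → proj₁ (centre-far w∈D′) }) covered unique j j<m
        where
        j<m : j < m
        j<m = *-cancelʳ-< q j m (≤-<-trans (m≤n+m (j * q) k)
                (s≤s⁻¹ (subst₂ _<_ pos≡ n≡ (pos<n v w))))
      ...   | w′ , w′∈D′ , pos≡′ = subst (_∈ D′) (pos-injective v (trans pos≡′ (sym pos≡))) w′∈D′

      D′≡D : D′ ≡ D v
      D′≡D = sym (⊆-∣∣-antisym D⊆D′ ∣D′∣≤∣D∣)

  module NonDivisible (r m : ℕ) (1≤r : 1 ≤ r) (r<q : r < q) (n≡ : n ≡ suc (r + m * q)) where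

    m<∣∣ : ∀ {D′} → IsDominating G (∁ ⁅ v₀ ⁆) D′ → m < ∣ D′ ∣
    m<∣∣ {D′} D′-dom = *-cancelʳ-< q m ∣ D′ ∣
      (≤-trans (+-monoˡ-≤ (m * q) 1≤r) (subst (_≤ ∣ D′ ∣ * q) (cong (_∸ 1) n≡) (punctured-bound D′-dom)))

    γ-set : ∀ P → P 0 ≡ false → Covers P → count n P ≤ suc m → IsGammaSet G (∁ ⁅ v₀ ⁆) (S v₀ P)
    γ-set P P0≡false covers count≤ = S-dominates-∁ v₀ P P0≡false covers ,
      λ D′ D′-dom → ≤-trans (≤-trans (≤-reflexive (∣S∣≡count v₀ P)) count≤) (m<∣∣ D′-dom)

    progression-γ : ∀ {a} → 1 ≤ a → a ≤ suc k → a ≤ r → r ≤ a + k → IsGammaSet G (∁ ⁅ v₀ ⁆) (S v₀ (progression a))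
    progression-γ {a} 1≤a a≤k+1 a≤r r≤a+k =
      γ-set (progression a) (progression-< 1≤a) (progression-covers m 1≤a a≤k+1 last<n n+k≤) count≤
      where
      last<n : a + m * q < n
      last<n = subst (a + m * q <_) (sym n≡) (s≤s (+-monoˡ-≤ (m * q) a≤r))
      n+k≤ : n + k ≤ a + suc m * q
      n+k≤ = begin
        n + k                     ≡⟨ cong (_+ k) n≡ ⟩
        suc (r + m * q) + k       ≤⟨ +-monoˡ-≤ k (s≤s (+-monoˡ-≤ (m * q) r≤a+k)) ⟩
        suc (a + k + m * q) + k   ≡⟨ rearrange a k m ⟩
        a + suc m * q             ∎
        where
        open ≤-Reasoning
        rearrange : ∀ a k m → suc (a + k + m * suc (2 * k)) + k ≡ a + suc m * suc (2 * k)
        rearrange = solve-∀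
      count≤ : count n (progression a) ≤ suc m
      count≤ = ≤-trans (count-mono (progression a) n≤) (≤-reflexive (count-progression a (suc m)))
        where
        n≤ : n ≤ a + suc m * q
        n≤ = subst (_≤ a + suc m * q) (sym n≡) (≤-trans (+-monoˡ-≤ (m * q) r<q) (m≤n+m (q + m * q) a))

    module LastVertex (r≡1 : r ≡ 1) where

      n∸1≡ : n ∸ 1 ≡ suc (m * q)
      n∸1≡ = trans (cong (_∸ 1) n≡) (cong (_+ m * q) r≡1)

      1≤m : 1 ≤ m
      1≤m = n≢0⇒n>0 λ m≡0 → <-irrefl refl (subst (2 <_) (trans n≡ (cong₂ (λ r m → suc (r + m * q)) r≡1 m≡0)) 2<n)

      m′ : ℕ
      m′ = m ∸ 1

      suc-m′ : suc m′ ≡ m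
      suc-m′ = m+[n∸m]≡n 1≤m

      -- The centres k + 1 + j q cover the positions 1 … m q; position n - 1 = m q + 1 covers itself.
      centres-and-last : ℕ → Bool
      centres-and-last y = progression (suc k) y ∨ (y ≡ᵇ n ∸ 1)

      covers : Covers centres-and-last
      covers {x} 1≤x x<n with x <? n ∸ 1
      ... | yes x<n∸1 with progression-covers-below m′ {n ∸ 1} (s≤s z≤n) ≤-refl last<n L+k≤ 1≤x x<n∸1
        where
        last<n : suc k + m′ * q < n
        last<n = subst (suc k + m′ * q <_) (sym (trans n≡ (cong (λ r → suc (r + m * q)) r≡1)))
                   (s≤s (≤-trans (+-monoˡ-≤ (m′ * q) (s≤s (m≤m+n k (k + 0))))
                                 (≤-trans (≤-reflexive (cong (_* q) suc-m′)) (n≤1+n _))))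
        L+k≤ : n ∸ 1 + k ≤ suc k + suc m′ * q
        L+k≤ = ≤-reflexive (trans (cong (_+ k) n∸1≡) (cong suc (trans (+-comm (m * q) k) (cong (λ t → k + t * q) (sym suc-m′)))))
      ...   | c , c<n , Pc , ∣x-c∣≤k = c , c<n , cong (_∨ (c ≡ᵇ n ∸ 1)) Pc , ∣x-c∣≤k
      covers {x} 1≤x x<n | no x≮n∸1 = x , x<n , is-last , subst (_≤ k) (sym (∣n-n∣≡0 x)) z≤n
        where
        x≡n∸1 : x ≡ n ∸ 1
        x≡n∸1 = ≤-antisym (subst (x ≤_) (pred[m∸n]≡m∸[1+n] n 0) (<⇒≤pred x<n)) (≮⇒≥ x≮n∸1)
        is-last : centres-and-last x ≡ true
        is-last = trans (cong (progression (suc k) x ∨_) (dec-true (x ≟ℕ n ∸ 1) x≡n∸1)) (∨-zeroʳ _)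

      centres-and-last-γ : IsGammaSet G (∁ ⁅ v₀ ⁆) (S v₀ centres-and-last)
      centres-and-last-γ = γ-set centres-and-last
        (trans (cong (_∨ (0 ≡ᵇ n ∸ 1)) (progression-< {suc k} (s≤s z≤n))) (cong (0 ≡ᵇ_) n∸1≡)) covers count≤
        where
        count≤ : count n centres-and-last ≤ suc m
        count≤ = ≤-trans (count-∨-≡ᵇ n (n ∸ 1) _)
          (≤-trans (+-monoˡ-≤ 1 (≤-trans (count-mono _ n≤) (≤-reflexive (count-progression (suc k) m)))) (≤-reflexive (+-comm m 1)))
          where
          n≤ : n ≤ suc k + m * q
          n≤ = subst (_≤ suc k + m * q) (sym (trans n≡ (cong (λ r → suc (r + m * q)) r≡1))) (s≤s (+-monoˡ-≤ (m * q) 1≤k))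

      centres-and-last-1 : centres-and-last 1 ≡ false
      centres-and-last-1 = trans (cong (_∨ (1 ≡ᵇ n ∸ 1)) (progression-< (s≤s 1≤k)))
        (dec-false (1 ≟ℕ n ∸ 1) λ 1≡n∸1 → <-irrefl refl (subst (1 <_) (sym 1≡n∸1) (∸-monoˡ-≤ 1 2<n)))

    differ-at : ∀ P Q {c} → c < n → P c ≡ true → Q c ≡ false → S v₀ P ≢ S v₀ Q
    differ-at P Q c<n Pc Qc S≡ = contradiction (trans (sym Pc) (trans (S-pointwise v₀ S≡ c<n) Qc)) λ ()

    r≤k+k : r ≤ k + k
    r≤k+k = subst (r ≤_) (cong (k +_) (+-identityʳ k)) (s≤s⁻¹ r<q)

    r<n : r < n
    r<n = subst (r <_) (sym n≡) (s≤s (m≤m+n r (m * q)))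

    two-γ-sets : ∃[ D₁ ] ∃[ D₂ ] IsGammaSet G (∁ ⁅ v₀ ⁆) D₁ × IsGammaSet G (∁ ⁅ v₀ ⁆) D₂ × D₁ ≢ D₂
    two-γ-sets with r ≤? suc k
    ... | no r≰k+1 =
      S v₀ (progression (r ∸ k)) , S v₀ (progression (suc k)) ,
      progression-γ 1≤r∸k (m≤n⇒m≤1+n r∸k≤k) (m∸n≤m r k) (≤-reflexive (sym (m∸n+n≡m k≤r))) ,
      progression-γ (s≤s z≤n) ≤-refl (<⇒≤ (≰⇒> r≰k+1)) (≤-trans r≤k+k (n≤1+n _)) ,
      differ-at (progression (r ∸ k)) (progression (suc k)) (≤-<-trans (m∸n≤m r k) r<n)
        (progression-self (r ∸ k)) (progression-< (s≤s r∸k≤k))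
      where
      k≤r : k ≤ r
      k≤r = ≤-trans (n≤1+n k) (<⇒≤ (≰⇒> r≰k+1))
      1≤r∸k : 1 ≤ r ∸ k
      1≤r∸k = m<n⇒0<n∸m (≤-trans (s≤s (n≤1+n k)) (≰⇒> r≰k+1))
      r∸k≤k : r ∸ k ≤ k
      r∸k≤k = subst (r ∸ k ≤_) (m+n∸m≡n k k) (∸-monoˡ-≤ k r≤k+k)
    ... | yes r≤k+1 with r ≤? 1
    ...   | no r≰1 =
      S v₀ (progression 1) , S v₀ (progression r) ,
      progression-γ ≤-refl (s≤s z≤n) 1≤r r≤k+1 ,
      progression-γ 1≤r r≤k+1 ≤-refl (m≤m+n r k) ,
      differ-at (progression 1) (progression r) 1<n (progression-self 1) (progression-< (≰⇒> r≰1))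
    ...   | yes r≤1 =
      S v₀ (progression 1) , S v₀ centres-and-last ,
      progression-γ ≤-refl (s≤s z≤n) 1≤r r≤k+1 ,
      centres-and-last-γ ,
      differ-at (progression 1) centres-and-last 1<n (progression-self 1) centres-and-last-1
      where open LastVertex (≤-antisym r≤1 1≤r)

    not-unique : ¬ HasUniqueGammaSet G (∁ ⁅ v₀ ⁆)
    not-unique (D , _ , γ≡D) with two-γ-sets
    ... | D₁ , D₂ , D₁-γ , D₂-γ , D₁≢D₂ = D₁≢D₂ (trans (γ≡D D₁ D₁-γ) (sym (γ≡D D₂ D₂-γ)))

  Δ≡2k : Δ G ≡ 2 * k
  Δ≡2k = Δ-regular G (2 * k) degree≡2k (<-trans (s≤s z≤n) 1<n)

  suc[n∸1]≡n : suc (n ∸ 1) ≡ n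
  suc[n∸1]≡n = m+[n∸m]≡n (<⇒≤ 1<n)

  divisible⇒ : q ∣ n ∸ 1 → ∃[ t ] n ≡ suc (suc t * q)
  divisible⇒ (divides zero n∸1≡0) = contradiction (trans (sym suc[n∸1]≡n) (cong suc n∸1≡0)) (>⇒≢ 1<n)
  divisible⇒ (divides (suc t) n∸1≡) = t , trans (sym suc[n∸1]≡n) (cong suc n∸1≡)

  divisible⇒hypo-unique : q ∣ n ∸ 1 → IsHypoUnique G
  divisible⇒hypo-unique q∣n∸1 with divisible⇒ q∣n∸1
  ... | t , n≡ = (E v₀ , E v₁ , E-γ v₀ , E-γ v₁ , E-distinct) ,
                 λ v → D v , D-γ v , λ D′ D′-γ → Minimum.D′≡D v D′-γ
    where open Divisible t n≡

  hypo-unique⇒divisible : IsHypoUnique G → q ∣ n ∸ 1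
  hypo-unique⇒divisible (_ , unique) with (n ∸ 1) % q in r≡
  ... | zero = m%n≡0⇒n∣m (n ∸ 1) q r≡
  ... | suc r′ = contradiction (unique v₀) (NonDivisible.not-unique (suc r′) ((n ∸ 1) / q) (s≤s z≤n) r<q n≡)
    where
    r<q : suc r′ < q
    r<q = subst (_< q) r≡ (m%n<n (n ∸ 1) q)
    n≡ : n ≡ suc (suc r′ + (n ∸ 1) / q * q)
    n≡ = trans (sym suc[n∸1]≡n) (cong suc (trans (m≡m%n+[m/n]*n (n ∸ 1) q) (cong (_+ (n ∸ 1) / q * q) r≡)))

  divisible⇒hypo-efficient : q ∣ n ∸ 1 →
    (∀ g → IsDominationNumber G ⊤ g → n ≡ (Δ G + 1) * (g ∸ 1) + 1) × IsHypoEfficient G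
  divisible⇒hypo-efficient q∣n∸1 with divisible⇒ q∣n∸1
  ... | t , n≡ = (λ g γ → trans n≡ (trans (formula k t)
                   (cong₂ (λ d g → (d + 1) * (g ∸ 1) + 1) (sym Δ≡2k) (sym (γ≡m+1 γ))))) ,
                 no-EDS , λ v → D v , D-EDS v
    where
    open Divisible t n≡
    formula : ∀ k t → suc (suc t * suc (2 * k)) ≡ (2 * k + 1) * suc t + 1
    formula = solve-∀

k<n/2⇒2k<n : ∀ {n k} → k < n / 2 → 2 * k < n
k<n/2⇒2k<n {n} {k} k<n/2 = begin-strict
  2 * k        <⟨ *-monoʳ-< 2 k<n/2 ⟩
  2 * (n / 2)  ≡⟨ *-comm 2 (n / 2) ⟩
  n / 2 * 2    ≤⟨ m/n*n≤m n 2 ⟩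
  n            ∎
  where open ≤-Reasoning

-- The hypothesis 4 ≤ n is implied by the others.
proposition3p19 : (n k : ℕ) → 4 ≤ n → 1 ≤ k → k < n / 2 →
    (IsHypoUnique (C n k) ⇔ (2 * k + 1 ∣ n ∸ 1))
    × ((2 * k + 1 ∣ n ∸ 1) →
        (∀ g → IsDominationNumber (C n k) ⊤ g →
           n ≡ (Δ (C n k) + 1) * (g ∸ 1) + 1)
        × IsHypoEfficient (C n k))
proposition3p19 n k _ 1≤k k<n/2 =
  mk⇔ (to-q ∘ hypo-unique⇒divisible) (divisible⇒hypo-unique ∘ from-q) ,
  divisible⇒hypo-efficient ∘ from-q
  where
  open Circulant n k 1≤k (k<n/2⇒2k<n k<n/2)
  from-q : 2 * k + 1 ∣ n ∸ 1 → q ∣ n ∸ 1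
  from-q = subst (_∣ n ∸ 1) (+-comm (2 * k) 1)
  to-q : q ∣ n ∸ 1 → 2 * k + 1 ∣ n ∸ 1
  to-q = subst (_∣ n ∸ 1) (+-comm 1 (2 * k))
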